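{- Define $\gamma_n\in\mathbb{Z}/2[t]$ for odd $n>0$ by $\gamma_1=0$, $\gamma_3=0$, $\gamma_5=t^3$, $\gamma_7=t^5$ and $\gamma_{n+8}=t^8\gamma_n+t^2\gamma_{n+2}$. Then for every odd $n>0$, $\gamma_n$ is a sum of monomials preceding $t^n$.
   Context: Let $g:\mathbb{N}\to\mathbb{N}$ be defined by $g(0)=0$, $g(2n)=4g(n)$, $g(2n+1)=g(2n)+1$. For $a,b\in\mathbb{N}$, $[a,b]$ denotes $t^{1+2g(a)+4g(b)}$; every $t^k$ with $k$ odd positive is uniquely of this form. Say $[c,d]$ precedes $[a,b]$ if $c+d<a+b$, or $c+d=a+b$ and $d<b$. "A sum of monomials" means a finite (possibly empty) sum of distinct monomials. -}

module Defs where

open import Data.Nat using (ℕ; zero; suc; _+_; _*_; _<_; _/_; _%_)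
open import Data.Bool using (Bool; true; false; _xor_)
open import Data.List using (List; []; _∷_; replicate; _++_)
open import Data.Product using (_×_; ∃-syntax)
open import Data.Sum using (_⊎_)
open import Relation.Binary.PropositionalEquality using (_≡_)

-- The map g : ℕ → ℕ with g 0 = 0, g (2n) = 4 g n, g (2n+1) = g (2n) + 1,
-- i.e. reinterpret the binary digits of n in base 4.  Computed with fuel
-- (fuel n ≥ number of binary digits of n suffices).
gAux : ℕ → ℕ → ℕ
gAux zero    _ = 0
gAux (suc f) n = n % 2 + 4 * gAux f (n / 2)

g : ℕ → ℕ
g n = gAux n n

bracket : ℕ → ℕ → ℕ
bracket a b = 1 + 2 * g a + 4 * g b

Precedes : ℕ → ℕ → ℕ → ℕ → Set
Precedes c d a b = (c + d < a + b) ⊎ ((c + d ≡ a + b) × (d < b))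

-- Polynomials over ℤ/2 as coefficient lists (index = exponent).
Poly : Set
Poly = List Bool

coeff : Poly → ℕ → Bool
coeff []       _       = false
coeff (x ∷ p)  zero    = x
coeff (x ∷ p)  (suc k) = coeff p k

_⊕_ : Poly → Poly → Poly
[]      ⊕ q       = q
(x ∷ p) ⊕ []      = x ∷ p
(x ∷ p) ⊕ (y ∷ q) = (x xor y) ∷ (p ⊕ q)

shift : ℕ → Poly → Poly
shift k p = replicate k false ++ p

mono : ℕ → Poly
mono k = shift k (true ∷ [])

-- γ' m = γ_{2m+1}:  γ_1 = 0, γ_3 = 0, γ_5 = t^3, γ_7 = t^5,
-- γ_{n+8} = t^8 γ_n + t^2 γ_{n+2}.
γ' : ℕ → Poly
γ' 0 = []
γ' 1 = []
γ' 2 = mono 3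
γ' 3 = mono 5
γ' (suc (suc (suc (suc m)))) = shift 8 (γ' m) ⊕ shift 2 (γ' (suc m))

SumOfMonomialsPreceding : Poly → ℕ → Set
SumOfMonomialsPreceding p n =
  ∀ k → coeff p k ≡ true →
    ∃[ a ] ∃[ b ] ∃[ c ] ∃[ d ]
      (n ≡ bracket a b × k ≡ bracket c d × Precedes c d a b)

-- Track a monomial t^e of γ_(2M+1) by the pair (M, e). The recursion adds (4, 8) or (3, 2) to it,
-- starting from (2, 3) and (3, 5), so M = 2 + 3k + r and e = 3 + 2(k + r). Writing r = 4i + s,
-- the coefficients satisfy Pascal's rule in (k, i) and vanish for s ≥ 2, so t^e occurs iff s ≤ 1
-- and k, i have disjoint binary digits. On the other side, t^(1 + 2n) = [a, b] exactly when a and b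
-- collect the bits of n in even and odd positions; the weights a + b and a + 2b of n are
-- subadditive (a carry never gains weight) and additive on carry-free sums. Comparing e = 1 + 2J
-- with M through the carry-free sum M + k = 2 + s + 4(k + i) shows that the weights of J are
-- ≤ and < those of M, which is precedence.
module Submission where

open import Defs
open import Data.Nat using (ℕ; zero; suc; _+_; _*_; _≤_; _<_; z≤n; s≤s; z<s; _%_; _/_; _≡ᵇ_; _≤ᵇ_; _⊔_)
open import Data.Nat.Properties
open import Data.Nat.DivMod
  using (m≡m%n+[m/n]*n; m%n<n; [m+kn]%n≡m%n; m*n%n≡0; +-distrib-/; m*n/n≡m; m<n⇒m%n≡m; m<n⇒m/n≡0; /-monoˡ-≤; m/n<m; m<n*o⇒m/o<n)
open import Data.Nat.Tactic.RingSolver using (solve-∀)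
open import Data.Bool using (Bool; true; false; _∧_; _xor_)
open import Data.Bool.Properties using (xor-same; xor-identityʳ; xor-comm; ∧-distribˡ-xor; ¬-not)
open import Data.List using ([]; _∷_)
open import Data.Product using (_×_; _,_; proj₁; proj₂; ∃-syntax)
open import Data.Sum using (inj₁; inj₂)
open import Relation.Binary.PropositionalEquality
  using (_≡_; refl; sym; trans; cong; cong₂; cong-app; subst; subst₂; module ≡-Reasoning)

bit-split : ∀ n → n ≡ n % 2 + 2 * (n / 2)
bit-split n = trans (m≡m%n+[m/n]*n n 2) (cong (n % 2 +_) (*-comm (n / 2) 2))

low-bit : ∀ {d} q → d < 2 → (d + 2 * q) % 2 ≡ d
low-bit {d} q d<2 = begin
  (d + 2 * q) % 2 ≡⟨ cong (λ m → (d + m) % 2) (*-comm 2 q) ⟩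
  (d + q * 2) % 2 ≡⟨ [m+kn]%n≡m%n d q 2 ⟩
  d % 2           ≡⟨ m<n⇒m%n≡m d<2 ⟩
  d               ∎
  where open ≡-Reasoning

high-bits : ∀ {d} q → d < 2 → (d + 2 * q) / 2 ≡ q
high-bits {d} q d<2 = begin
  (d + 2 * q) / 2   ≡⟨ cong (λ m → (d + m) / 2) (*-comm 2 q) ⟩
  (d + q * 2) / 2   ≡⟨ +-distrib-/ d (q * 2) no-carry ⟩
  d / 2 + q * 2 / 2 ≡⟨ cong₂ _+_ (m<n⇒m/n≡0 d<2) (m*n/n≡m q 2) ⟩
  q                 ∎
  where
  open ≡-Reasoning
  no-carry : d % 2 + q * 2 % 2 < 2
  no-carry = subst (_< 2) (sym (trans (cong₂ _+_ (m<n⇒m%n≡m d<2) (m*n%n≡0 q 2)) (+-identityʳ d))) d<2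

/2-≤-pred : ∀ {n f} → n ≤ suc f → n / 2 ≤ f
/2-≤-pred {n} {f} n≤1+f = ≤-pred (≤-<-trans (/-monoˡ-≤ 2 n≤1+f) (m/n<m (suc f) 2 (s≤s (s≤s z≤n))))

-- Folds step over the binary digits of n, least significant first. Any fuel f ≥ n suffices, and
-- step 0 z ≡ z makes surplus fuel (leading zeros) harmless.
module BitFold {X : Set} (z : X) (step : ℕ → X → X) where

  foldBitsFuel : ℕ → ℕ → X
  foldBitsFuel zero    _ = z
  foldBitsFuel (suc f) n = step (n % 2) (foldBitsFuel f (n / 2))

  foldBits : ℕ → X
  foldBits n = foldBitsFuel n n

  module _ (step-0-z : step 0 z ≡ z) where

    foldBitsFuel-0 : ∀ f → foldBitsFuel f 0 ≡ z
    foldBitsFuel-0 zero    = refl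
    foldBitsFuel-0 (suc f) = trans (cong (step 0) (foldBitsFuel-0 f)) step-0-z

    foldBitsFuel-irrelevant : ∀ {f f' n} → n ≤ f → n ≤ f' → foldBitsFuel f n ≡ foldBitsFuel f' n
    foldBitsFuel-irrelevant {zero}  {f'}     z≤n _ = sym (foldBitsFuel-0 f')
    foldBitsFuel-irrelevant {suc f} {zero}   z≤n _ = foldBitsFuel-0 (suc f)
    foldBitsFuel-irrelevant {suc f} {suc f'} {n} n≤f n≤f' =
      cong (step (n % 2)) (foldBitsFuel-irrelevant (/2-≤-pred n≤f) (/2-≤-pred n≤f'))

    foldBits-unfold : ∀ n → foldBits n ≡ step (n % 2) (foldBits (n / 2))
    foldBits-unfold zero    = sym step-0-z
    foldBits-unfold (suc n) =
      cong (step (suc n % 2)) (foldBitsFuel-irrelevant {n} (/2-≤-pred ≤-refl) ≤-refl)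

    foldBits-bit : ∀ d q → d < 2 → foldBits (d + 2 * q) ≡ step d (foldBits q)
    foldBits-bit d q d<2 =
      trans (foldBits-unfold (d + 2 * q)) (cong₂ step (low-bit q d<2) (cong foldBits (high-bits q d<2)))

bitwise-induction : ∀ {p} (P : ℕ → ℕ → Set p) → P 0 0 →
                    (∀ d e a b → d < 2 → e < 2 → P a b → P (d + 2 * a) (e + 2 * b)) →
                    ∀ x y → P x y
bitwise-induction P base step x y = bounded x y (m≤m⊔n x y) (m≤n⊔m x y)
  where
  bounded : ∀ {n} x y → x ≤ n → y ≤ n → P x y
  bounded {zero}  zero    zero    _  _  = base
  bounded {zero}  (suc _) _       () _
  bounded {zero}  zero    (suc _) _  ()
  bounded {suc n} x    y    x≤n y≤n =
    subst₂ P (sym (bit-split x)) (sym (bit-split y))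
      (step (x % 2) (y % 2) (x / 2) (y / 2) (m%n<n x 2) (m%n<n y 2)
        (bounded (x / 2) (y / 2) (/2-≤-pred x≤n) (/2-≤-pred y≤n)))

bit-induction : ∀ {p} (P : ℕ → Set p) → P 0 → (∀ d q → d < 2 → P q → P (d + 2 * q)) → ∀ n → P n
bit-induction P base step n =
  bitwise-induction (λ x _ → P x) base (λ d _ a _ d<2 _ → step d a d<2) n 0

module GFold = BitFold 0 (λ d r → d + 4 * r)

gAux≡foldBitsFuel : ∀ f n → gAux f n ≡ GFold.foldBitsFuel f n
gAux≡foldBitsFuel zero    n = refl
gAux≡foldBitsFuel (suc f) n = cong (λ r → n % 2 + 4 * r) (gAux≡foldBitsFuel f (n / 2))

g-bit : ∀ d q → d < 2 → g (d + 2 * q) ≡ d + 4 * g q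
g-bit d q d<2 = begin
  g (d + 2 * q)          ≡⟨ gAux≡foldBitsFuel (d + 2 * q) (d + 2 * q) ⟩
  GFold.foldBits (d + 2 * q) ≡⟨ GFold.foldBits-bit refl d q d<2 ⟩
  d + 4 * GFold.foldBits q   ≡⟨ cong (λ r → d + 4 * r) (gAux≡foldBitsFuel q q) ⟨
  d + 4 * g q            ∎
  where open ≡-Reasoning

module Deinterleave = BitFold (0 , 0) (λ d p → (d + 2 * proj₂ p , proj₁ p))

deinterleave : ℕ → ℕ × ℕ
deinterleave = Deinterleave.foldBits

-- The bits of n in even and odd positions, read as binary numbers.
evens odds : ℕ → ℕ
evens n = proj₁ (deinterleave n)
odds  n = proj₂ (deinterleave n)

deinterleave-bit : ∀ d q → d < 2 → deinterleave (d + 2 * q) ≡ (d + 2 * odds q , evens q)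
deinterleave-bit = Deinterleave.foldBits-bit refl

evens-bit : ∀ d q → d < 2 → evens (d + 2 * q) ≡ d + 2 * odds q
evens-bit d q d<2 = cong proj₁ (deinterleave-bit d q d<2)

odds-bit : ∀ d q → d < 2 → odds (d + 2 * q) ≡ evens q
odds-bit d q d<2 = cong proj₂ (deinterleave-bit d q d<2)

interleave-evens-odds : ∀ n → g (evens n) + 2 * g (odds n) ≡ n
interleave-evens-odds = bit-induction _ refl λ d q d<2 ih → begin
  g (evens (d + 2 * q)) + 2 * g (odds (d + 2 * q))
    ≡⟨ cong₂ (λ a b → g a + 2 * g b) (evens-bit d q d<2) (odds-bit d q d<2) ⟩
  g (d + 2 * odds q) + 2 * g (evens q)
    ≡⟨ cong (_+ 2 * g (evens q)) (g-bit d (odds q) d<2) ⟩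
  d + 4 * g (odds q) + 2 * g (evens q)
    ≡⟨ regroup d (g (evens q)) (g (odds q)) ⟩
  d + 2 * (g (evens q) + 2 * g (odds q))
    ≡⟨ cong (λ m → d + 2 * m) ih ⟩
  d + 2 * q ∎
  where
  open ≡-Reasoning
  regroup : ∀ d a b → d + 4 * b + 2 * a ≡ d + 2 * (a + 2 * b)
  regroup = solve-∀

-- The quantities c + d and c + 2d of [c, d] = t^(1 + 2n) that Precedes compares.
w₁ w₂ : ℕ → ℕ
w₁ n = evens n + odds n
w₂ n = evens n + 2 * odds n

w₁-bit : ∀ d q → d < 2 → w₁ (d + 2 * q) ≡ d + w₂ q
w₁-bit d q d<2 = trans (cong₂ _+_ (evens-bit d q d<2) (odds-bit d q d<2)) (regroup d (evens q) (odds q))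
  where
  regroup : ∀ d a b → d + 2 * b + a ≡ d + (a + 2 * b)
  regroup = solve-∀

w₂-bit : ∀ d q → d < 2 → w₂ (d + 2 * q) ≡ d + 2 * w₁ q
w₂-bit d q d<2 =
  trans (cong₂ (λ a b → a + 2 * b) (evens-bit d q d<2) (odds-bit d q d<2)) (regroup d (evens q) (odds q))
  where
  regroup : ∀ d a b → d + 2 * b + 2 * a ≡ d + 2 * (a + b)
  regroup = solve-∀

full-adder : ∀ {c d e} → c < 2 → d < 2 → e < 2 →
             ∃[ s ] ∃[ c' ] (s < 2 × c' < 2 × c + d + e ≡ s + 2 * c')
full-adder {c} {d} {e} c<2 d<2 e<2 =
  t % 2 , t / 2 , m%n<n t 2 , m<n*o⇒m/o<n t<4 , bit-split t
  where
  t = c + d + e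
  t<4 : t < 2 * 2
  t<4 = s≤s (+-mono-≤ (+-mono-≤ (≤-pred c<2) (≤-pred d<2)) (≤-pred e<2))

carry-split : ∀ c d e a b s c' → c + d + e ≡ s + 2 * c' →
              c + (d + 2 * a) + (e + 2 * b) ≡ s + 2 * (c' + a + b)
carry-split c d e a b s c' c+d+e≡ = begin
  c + (d + 2 * a) + (e + 2 * b) ≡⟨ split-digits c d e a b ⟩
  (c + d + e) + 2 * (a + b)     ≡⟨ cong (_+ 2 * (a + b)) c+d+e≡ ⟩
  s + 2 * c' + 2 * (a + b)      ≡⟨ join-carry s c' a b ⟩
  s + 2 * (c' + a + b)          ∎
  where
  open ≡-Reasoning
  split-digits : ∀ c d e a b → c + (d + 2 * a) + (e + 2 * b) ≡ (c + d + e) + 2 * (a + b)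
  split-digits = solve-∀
  join-carry : ∀ s c' a b → s + 2 * c' + 2 * (a + b) ≡ s + 2 * (c' + a + b)
  join-carry = solve-∀

-- Adding with an incoming carry c: the bit lemmas turn w(c + x + y) into s + w'(c' + a + b)
-- for the halves a, b and outgoing carry c', and s + c' ≤ s + 2 c' = c + d + e.
w-subadditive-carry : ∀ x y c → c < 2 →
                      w₁ (c + x + y) ≤ c + w₁ x + w₁ y × w₂ (c + x + y) ≤ c + w₂ x + w₂ y
w-subadditive-carry = bitwise-induction _ base step
  where
  base : ∀ c → c < 2 → w₁ (c + 0 + 0) ≤ c + w₁ 0 + w₁ 0 × w₂ (c + 0 + 0) ≤ c + w₂ 0 + w₂ 0
  base 0 _                        = z≤n , z≤n
  base 1 _                        = ≤-refl , ≤-refl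
  base (suc (suc _)) (s≤s (s≤s ()))

  step : ∀ d e a b → d < 2 → e < 2 →
         (∀ c → c < 2 → w₁ (c + a + b) ≤ c + w₁ a + w₁ b × w₂ (c + a + b) ≤ c + w₂ a + w₂ b) →
         ∀ c → c < 2 → w₁ (c + (d + 2 * a) + (e + 2 * b)) ≤ c + w₁ (d + 2 * a) + w₁ (e + 2 * b)
                     × w₂ (c + (d + 2 * a) + (e + 2 * b)) ≤ c + w₂ (d + 2 * a) + w₂ (e + 2 * b)
  step d e a b d<2 e<2 ih c c<2 with full-adder c<2 d<2 e<2
  ... | s , c' , s<2 , c'<2 , c+d+e≡ = w₁-step , w₂-step
    where
    open ≤-Reasoning

    sum≡ : c + (d + 2 * a) + (e + 2 * b) ≡ s + 2 * (c' + a + b)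
    sum≡ = carry-split c d e a b s c' c+d+e≡

    w₁-step : w₁ (c + (d + 2 * a) + (e + 2 * b)) ≤ c + w₁ (d + 2 * a) + w₁ (e + 2 * b)
    w₁-step = begin
      w₁ (c + (d + 2 * a) + (e + 2 * b)) ≡⟨ cong w₁ sum≡ ⟩
      w₁ (s + 2 * (c' + a + b))          ≡⟨ w₁-bit s (c' + a + b) s<2 ⟩
      s + w₂ (c' + a + b)                ≤⟨ +-monoʳ-≤ s (proj₂ (ih c' c'<2)) ⟩
      s + (c' + w₂ a + w₂ b)             ≤⟨ +-monoʳ-≤ s (+-monoˡ-≤ (w₂ b) (+-monoˡ-≤ (w₂ a) (m≤n*m c' 2))) ⟩
      s + (2 * c' + w₂ a + w₂ b)         ≡⟨ regroup s (2 * c') (w₂ a) (w₂ b) ⟩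
      (s + 2 * c') + w₂ a + w₂ b         ≡⟨ cong (λ t → t + w₂ a + w₂ b) c+d+e≡ ⟨
      (c + d + e) + w₂ a + w₂ b          ≡⟨ distribute c d e (w₂ a) (w₂ b) ⟩
      c + (d + w₂ a) + (e + w₂ b)        ≡⟨ cong₂ (λ u v → c + u + v) (w₁-bit d a d<2) (w₁-bit e b e<2) ⟨
      c + w₁ (d + 2 * a) + w₁ (e + 2 * b) ∎
      where
      regroup : ∀ s t p q → s + (t + p + q) ≡ (s + t) + p + q
      regroup = solve-∀
      distribute : ∀ c d e p q → (c + d + e) + p + q ≡ c + (d + p) + (e + q)
      distribute = solve-∀

    w₂-step : w₂ (c + (d + 2 * a) + (e + 2 * b)) ≤ c + w₂ (d + 2 * a) + w₂ (e + 2 * b)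
    w₂-step = begin
      w₂ (c + (d + 2 * a) + (e + 2 * b)) ≡⟨ cong w₂ sum≡ ⟩
      w₂ (s + 2 * (c' + a + b))          ≡⟨ w₂-bit s (c' + a + b) s<2 ⟩
      s + 2 * w₁ (c' + a + b)            ≤⟨ +-monoʳ-≤ s (*-monoʳ-≤ 2 (proj₁ (ih c' c'<2))) ⟩
      s + 2 * (c' + w₁ a + w₁ b)         ≡⟨ distribute s c' (w₁ a) (w₁ b) ⟩
      (s + 2 * c') + 2 * w₁ a + 2 * w₁ b ≡⟨ cong (λ t → t + 2 * w₁ a + 2 * w₁ b) c+d+e≡ ⟨
      (c + d + e) + 2 * w₁ a + 2 * w₁ b  ≡⟨ regroup c d e (2 * w₁ a) (2 * w₁ b) ⟩
      c + (d + 2 * w₁ a) + (e + 2 * w₁ b) ≡⟨ cong₂ (λ u v → c + u + v) (w₂-bit d a d<2) (w₂-bit e b e<2) ⟨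
      c + w₂ (d + 2 * a) + w₂ (e + 2 * b) ∎
      where
      distribute : ∀ s c' p q → s + 2 * (c' + p + q) ≡ (s + 2 * c') + 2 * p + 2 * q
      distribute = solve-∀
      regroup : ∀ c d e p q → (c + d + e) + p + q ≡ c + (d + p) + (e + q)
      regroup = solve-∀

w₁-subadditive : ∀ x y → w₁ (x + y) ≤ w₁ x + w₁ y
w₁-subadditive x y = proj₁ (w-subadditive-carry x y 0 (s≤s z≤n))

w₂-subadditive : ∀ x y → w₂ (x + y) ≤ w₂ x + w₂ y
w₂-subadditive x y = proj₂ (w-subadditive-carry x y 0 (s≤s z≤n))

-- carryFree k i: the binary digits of k and i are disjoint (by Lucas: C(k + i, k) is odd).
module CarryFree = BitFold (λ _ → true) (λ d r i → (d * (i % 2) ≡ᵇ 0) ∧ r (i / 2))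

carryFree : ℕ → ℕ → Bool
carryFree = CarryFree.foldBits

carryFree-bits : ∀ d e a b → d < 2 → e < 2 →
                 carryFree (d + 2 * a) (e + 2 * b) ≡ (d * e ≡ᵇ 0) ∧ carryFree a b
carryFree-bits d e a b d<2 e<2 =
  trans (cong-app (CarryFree.foldBits-bit refl d a d<2) (e + 2 * b))
        (cong₂ (λ u v → (d * u ≡ᵇ 0) ∧ carryFree a v) (low-bit b e<2) (high-bits b e<2))

carryFree-zeroʳ : ∀ k → carryFree k 0 ≡ true
carryFree-zeroʳ = bit-induction _ refl λ d q d<2 ih →
  trans (carryFree-bits d 0 q 0 d<2 (s≤s z≤n)) (cong₂ (λ u v → (u ≡ᵇ 0) ∧ v) (*-zeroʳ d) ih)

carryFree-pascal : ∀ k i → carryFree (suc k) (suc i) ≡ carryFree k (suc i) xor carryFree (suc k) i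
carryFree-pascal = bitwise-induction _ refl step
  where
  open ≡-Reasoning
  bits : ∀ d e a b → {{d < 2}} → {{e < 2}} → carryFree (d + 2 * a) (e + 2 * b) ≡ (d * e ≡ᵇ 0) ∧ carryFree a b
  bits d e a b {{d<2}} {{e<2}} = carryFree-bits d e a b d<2 e<2
  instance
    0<2 : 0 < 2
    0<2 = z<s
    1<2 : 1 < 2
    1<2 = n<1+n 1
  step : ∀ d e a b → d < 2 → e < 2 →
         carryFree (suc a) (suc b) ≡ carryFree a (suc b) xor carryFree (suc a) b →
         carryFree (suc (d + 2 * a)) (suc (e + 2 * b))
           ≡ carryFree (d + 2 * a) (suc (e + 2 * b)) xor carryFree (suc (d + 2 * a)) (e + 2 * b)
  step 0 0 a b _ _ _ = begin
    carryFree (1 + 2 * a) (1 + 2 * b)                           ≡⟨ bits 1 1 a b ⟩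
    false                                                       ≡⟨ xor-same (carryFree a b) ⟨
    carryFree a b xor carryFree a b                             ≡⟨ cong₂ _xor_ (bits 0 1 a b) (bits 1 0 a b) ⟨
    carryFree (0 + 2 * a) (1 + 2 * b) xor carryFree (1 + 2 * a) (0 + 2 * b) ∎
  step 0 1 a b _ _ _ = begin
    carryFree (1 + 2 * a) (2 + 2 * b)                           ≡⟨ cong (carryFree (1 + 2 * a)) (*-suc 2 b) ⟨
    carryFree (1 + 2 * a) (0 + 2 * suc b)                       ≡⟨ bits 1 0 a (suc b) ⟩
    carryFree a (suc b)                                         ≡⟨ xor-identityʳ _ ⟨
    carryFree a (suc b) xor false                               ≡⟨ cong₂ _xor_ (bits 0 0 a (suc b)) (bits 1 1 a b) ⟨
    carryFree (0 + 2 * a) (0 + 2 * suc b) xor carryFree (1 + 2 * a) (1 + 2 * b)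
      ≡⟨ cong (λ j → carryFree (2 * a) j xor carryFree (1 + 2 * a) (1 + 2 * b)) (*-suc 2 b) ⟩
    carryFree (0 + 2 * a) (2 + 2 * b) xor carryFree (1 + 2 * a) (1 + 2 * b) ∎
  step 1 0 a b _ _ _ = begin
    carryFree (2 + 2 * a) (1 + 2 * b)                           ≡⟨ cong (λ k → carryFree k (1 + 2 * b)) (*-suc 2 a) ⟨
    carryFree (0 + 2 * suc a) (1 + 2 * b)                       ≡⟨ bits 0 1 (suc a) b ⟩
    carryFree (suc a) b                                         ≡⟨ cong₂ _xor_ (bits 1 1 a b) (bits 0 0 (suc a) b) ⟨
    carryFree (1 + 2 * a) (1 + 2 * b) xor carryFree (0 + 2 * suc a) (0 + 2 * b)
      ≡⟨ cong (λ k → carryFree (1 + 2 * a) (1 + 2 * b) xor carryFree k (2 * b)) (*-suc 2 a) ⟩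
    carryFree (1 + 2 * a) (1 + 2 * b) xor carryFree (2 + 2 * a) (0 + 2 * b) ∎
  step 1 1 a b _ _ ih = begin
    carryFree (2 + 2 * a) (2 + 2 * b)                           ≡⟨ cong₂ carryFree (*-suc 2 a) (*-suc 2 b) ⟨
    carryFree (0 + 2 * suc a) (0 + 2 * suc b)                   ≡⟨ bits 0 0 (suc a) (suc b) ⟩
    carryFree (suc a) (suc b)                                   ≡⟨ ih ⟩
    carryFree a (suc b) xor carryFree (suc a) b                 ≡⟨ cong₂ _xor_ (bits 1 0 a (suc b)) (bits 0 1 (suc a) b) ⟨
    carryFree (1 + 2 * a) (0 + 2 * suc b) xor carryFree (0 + 2 * suc a) (1 + 2 * b)
      ≡⟨ cong₂ (λ j k → carryFree (1 + 2 * a) j xor carryFree k (1 + 2 * b)) (*-suc 2 b) (*-suc 2 a) ⟩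
    carryFree (1 + 2 * a) (2 + 2 * b) xor carryFree (2 + 2 * a) (1 + 2 * b) ∎
  step (suc (suc _)) _ _ _ (s≤s (s≤s ())) _ _
  step _ (suc (suc _)) _ _ _ (s≤s (s≤s ())) _

carryFree-bits-true : ∀ d e a b → d < 2 → e < 2 → carryFree (d + 2 * a) (e + 2 * b) ≡ true →
                      d + e < 2 × carryFree a b ≡ true
carryFree-bits-true 0 e a b _ e<2 h = e<2 , trans (sym (carryFree-bits 0 e a b z<s e<2)) h
carryFree-bits-true 1 0 a b _ _ h = n<1+n 1 , trans (sym (carryFree-bits 1 0 a b (n<1+n 1) z<s)) h
carryFree-bits-true 1 1 a b _ _ h with trans (sym (carryFree-bits 1 1 a b (n<1+n 1) (n<1+n 1))) h
... | ()
carryFree-bits-true (suc (suc _)) _ _ _ (s≤s (s≤s ())) _ _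
carryFree-bits-true 1 (suc (suc _)) _ _ _ (s≤s (s≤s ())) _

w-additive : ∀ x y → carryFree x y ≡ true → w₁ (x + y) ≡ w₁ x + w₁ y × w₂ (x + y) ≡ w₂ x + w₂ y
w-additive = bitwise-induction _ (λ _ → refl , refl) step
  where
  open ≡-Reasoning
  step : ∀ d e a b → d < 2 → e < 2 →
         (carryFree a b ≡ true → w₁ (a + b) ≡ w₁ a + w₁ b × w₂ (a + b) ≡ w₂ a + w₂ b) →
         carryFree (d + 2 * a) (e + 2 * b) ≡ true →
         w₁ (d + 2 * a + (e + 2 * b)) ≡ w₁ (d + 2 * a) + w₁ (e + 2 * b)
         × w₂ (d + 2 * a + (e + 2 * b)) ≡ w₂ (d + 2 * a) + w₂ (e + 2 * b)
  step d e a b d<2 e<2 ih h = w₁-step , w₂-step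
    where
    digits = carryFree-bits-true d e a b d<2 e<2 h
    d+e<2 = proj₁ digits
    ih₁ = proj₁ (ih (proj₂ digits))
    ih₂ = proj₂ (ih (proj₂ digits))

    sum≡ : d + 2 * a + (e + 2 * b) ≡ (d + e) + 2 * (a + b)
    sum≡ = regroup d e a b
      where
      regroup : ∀ d e a b → d + 2 * a + (e + 2 * b) ≡ (d + e) + 2 * (a + b)
      regroup = solve-∀

    w₁-step : w₁ (d + 2 * a + (e + 2 * b)) ≡ w₁ (d + 2 * a) + w₁ (e + 2 * b)
    w₁-step = begin
      w₁ (d + 2 * a + (e + 2 * b))        ≡⟨ cong w₁ sum≡ ⟩
      w₁ ((d + e) + 2 * (a + b))          ≡⟨ w₁-bit (d + e) (a + b) d+e<2 ⟩
      (d + e) + w₂ (a + b)                ≡⟨ cong ((d + e) +_) ih₂ ⟩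
      (d + e) + (w₂ a + w₂ b)             ≡⟨ regroup d e (w₂ a) (w₂ b) ⟩
      (d + w₂ a) + (e + w₂ b)             ≡⟨ cong₂ _+_ (w₁-bit d a d<2) (w₁-bit e b e<2) ⟨
      w₁ (d + 2 * a) + w₁ (e + 2 * b)     ∎
      where
      regroup : ∀ d e p q → (d + e) + (p + q) ≡ (d + p) + (e + q)
      regroup = solve-∀

    w₂-step : w₂ (d + 2 * a + (e + 2 * b)) ≡ w₂ (d + 2 * a) + w₂ (e + 2 * b)
    w₂-step = begin
      w₂ (d + 2 * a + (e + 2 * b))        ≡⟨ cong w₂ sum≡ ⟩
      w₂ ((d + e) + 2 * (a + b))          ≡⟨ w₂-bit (d + e) (a + b) d+e<2 ⟩
      (d + e) + 2 * w₁ (a + b)            ≡⟨ cong (λ t → (d + e) + 2 * t) ih₁ ⟩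
      (d + e) + 2 * (w₁ a + w₁ b)         ≡⟨ regroup d e (w₁ a) (w₁ b) ⟩
      (d + 2 * w₁ a) + (e + 2 * w₁ b)     ≡⟨ cong₂ _+_ (w₂-bit d a d<2) (w₂-bit e b e<2) ⟨
      w₂ (d + 2 * a) + w₂ (e + 2 * b)     ∎
      where
      regroup : ∀ d e p q → (d + e) + 2 * (p + q) ≡ (d + 2 * p) + (e + 2 * q)
      regroup = solve-∀

carryFree-quad : ∀ c m → c < 4 → carryFree c (4 * m) ≡ true
carryFree-quad c m c<4 = trans (cong (carryFree c) (quadruple m)) (small c c<4)
  where
  quadruple : ∀ m → 4 * m ≡ 2 * (2 * m)
  quadruple = *-assoc 2 2
  1-even : ∀ q → carryFree 1 (2 * q) ≡ true
  1-even q = carryFree-bits 1 0 0 q (n<1+n 1) z<s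
  small : ∀ c → c < 4 → carryFree c (2 * (2 * m)) ≡ true
  small 0 _ = refl
  small 1 _ = 1-even (2 * m)
  small 2 _ = trans (carryFree-bits 0 0 1 (2 * m) z<s z<s) (1-even m)
  small 3 _ = trans (carryFree-bits 1 0 1 (2 * m) (n<1+n 1) z<s) (1-even m)
  small (suc (suc (suc (suc _)))) (s≤s (s≤s (s≤s (s≤s ()))))

w-quad : ∀ c m → c < 4 → w₁ (c + 4 * m) ≡ w₁ c + 2 * w₁ m × w₂ (c + 4 * m) ≡ w₂ c + 2 * w₂ m
w-quad c m c<4 =
  trans (proj₁ additive) (cong (w₁ c +_) w₁-quadruple) ,
  trans (proj₂ additive) (cong (w₂ c +_) w₂-quadruple)
  where
  additive = w-additive c (4 * m) (carryFree-quad c m c<4)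
  quadruple : 4 * m ≡ 2 * (2 * m)
  quadruple = *-assoc 2 2 m
  w₁-quadruple : w₁ (4 * m) ≡ 2 * w₁ m
  w₁-quadruple = trans (cong w₁ quadruple) (trans (w₁-bit 0 (2 * m) z<s) (w₂-bit 0 m z<s))
  w₂-quadruple : w₂ (4 * m) ≡ 2 * w₂ m
  w₂-quadruple = trans (cong w₂ quadruple) (trans (w₂-bit 0 (2 * m) z<s) (cong (2 *_) (w₁-bit 0 m z<s)))

-- Compares J = k + (c + 4 i) with M = c' + 4 i + 3 k through M + k = c' + 4 (k + i),
-- on which w is exactly additive.
weight-exchange : (w : ℕ → ℕ) → (∀ x y → w (x + y) ≤ w x + w y) →
                  (∀ c m → c < 4 → w (c + 4 * m) ≡ w c + 2 * w m) →
                  ∀ k i c c' → w (k + i) ≡ w k + w i → c < 4 → c' < 4 →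
                  w (k + (c + 4 * i)) + w c' ≤ w c + w (c' + 4 * i + 3 * k)
weight-exchange w subadditive quad k i c c' additive c<4 c'<4 =
  +-cancelʳ-≤ (w k) _ _ (begin
    w (k + (c + 4 * i)) + w c' + w k
      ≤⟨ +-monoˡ-≤ (w k) (+-monoˡ-≤ (w c') (subadditive k (c + 4 * i))) ⟩
    w k + w (c + 4 * i) + w c' + w k
      ≡⟨ cong (λ t → w k + t + w c' + w k) (quad c i c<4) ⟩
    w k + (w c + 2 * w i) + w c' + w k
      ≡⟨ regroup (w k) (w c) (w i) (w c') ⟩
    w c + (w c' + 2 * (w k + w i))
      ≡⟨ cong (λ t → w c + (w c' + 2 * t)) additive ⟨
    w c + (w c' + 2 * w (k + i))
      ≡⟨ cong (w c +_) (quad c' (k + i) c'<4) ⟨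
    w c + w (c' + 4 * (k + i))
      ≡⟨ cong (λ t → w c + w t) (M+k c' i k) ⟩
    w c + w (c' + 4 * i + 3 * k + k)
      ≤⟨ +-monoʳ-≤ (w c) (subadditive (c' + 4 * i + 3 * k) k) ⟩
    w c + (w (c' + 4 * i + 3 * k) + w k)
      ≡⟨ +-assoc (w c) _ (w k) ⟨
    w c + w (c' + 4 * i + 3 * k) + w k ∎)
  where
  open ≤-Reasoning
  regroup : ∀ x y z u → x + (y + 2 * z) + u + x ≡ y + (u + 2 * (x + z))
  regroup = solve-∀
  M+k : ∀ c' i k → c' + 4 * (k + i) ≡ c' + 4 * i + 3 * k + k
  M+k = solve-∀

coeff-⊕ : ∀ p q k → coeff (p ⊕ q) k ≡ coeff p k xor coeff q k
coeff-⊕ []      q       k       = refl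
coeff-⊕ (x ∷ p) []      k       = sym (xor-identityʳ _)
coeff-⊕ (x ∷ p) (y ∷ q) zero    = refl
coeff-⊕ (x ∷ p) (y ∷ q) (suc k) = coeff-⊕ p q k

coeff-shift : ∀ n p k → coeff (shift n p) (n + k) ≡ coeff p k
coeff-shift zero    p k = refl
coeff-shift (suc n) p k = coeff-shift n p k

coeff-shift-true : ∀ n p k → coeff (shift n p) k ≡ true → ∃[ j ] (k ≡ n + j × coeff p j ≡ true)
coeff-shift-true zero    p k       h = k , refl , h
coeff-shift-true (suc n) p (suc k) h =
  let j , k≡ , hj = coeff-shift-true n p k h in j , cong suc k≡ , hj

coeff-mono-true : ∀ n k → coeff (mono n) k ≡ true → k ≡ n
coeff-mono-true n k h with coeff-shift-true n (true ∷ []) k h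
... | zero , k≡ , _ = trans k≡ (+-identityʳ n)

index exponent : ℕ → ℕ → ℕ
index    k r = 2 + 3 * k + r
exponent k r = 3 + 2 * (k + r)

index-+4 : ∀ k r → index k (4 + r) ≡ 4 + index k r
index-+4 = lemma
  where
  lemma : ∀ k r → 2 + 3 * k + (4 + r) ≡ 4 + (2 + 3 * k + r)
  lemma = solve-∀

exponent-+4 : ∀ k r → exponent k (4 + r) ≡ 8 + exponent k r
exponent-+4 = lemma
  where
  lemma : ∀ k r → 3 + 2 * (k + (4 + r)) ≡ 8 + (3 + 2 * (k + r))
  lemma = solve-∀

index-suc : ∀ k r → index (suc k) r ≡ 3 + index k r
index-suc = lemma
  where
  lemma : ∀ k r → 2 + 3 * suc k + r ≡ 3 + (2 + 3 * k + r)
  lemma = solve-∀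

exponent-suc : ∀ k r → exponent (suc k) r ≡ 2 + exponent k r
exponent-suc = lemma
  where
  lemma : ∀ k r → 3 + 2 * (suc k + r) ≡ 2 + (3 + 2 * (k + r))
  lemma = solve-∀

index-exponent-injective : ∀ {k r k' r'} → index k r ≡ index k' r' → exponent k r ≡ exponent k' r' →
                           k ≡ k' × r ≡ r'
index-exponent-injective {k} {r} {k'} {r'} index≡ exponent≡ = k≡k' , r≡r'
  where
  open ≡-Reasoning
  sum≡ : k + r ≡ k' + r'
  sum≡ = *-cancelˡ-≡ (k + r) (k' + r') 2 (+-cancelˡ-≡ 3 _ _ exponent≡)
  split : ∀ k r → 3 * k + r ≡ 2 * k + (k + r)
  split = solve-∀
  k≡k' : k ≡ k'
  k≡k' = *-cancelˡ-≡ k k' 2 (+-cancelʳ-≡ (k' + r') _ _ (begin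
    2 * k + (k' + r')  ≡⟨ cong (2 * k +_) sum≡ ⟨
    2 * k + (k + r)    ≡⟨ split k r ⟨
    3 * k + r          ≡⟨ +-cancelˡ-≡ 2 _ _ index≡ ⟩
    3 * k' + r'        ≡⟨ split k' r' ⟩
    2 * k' + (k' + r') ∎))
  r≡r' : r ≡ r'
  r≡r' = +-cancelˡ-≡ k _ _ (trans sum≡ (cong (_+ r') (sym k≡k')))

Supported : ℕ → Set
Supported M = ∀ e → coeff (γ' M) e ≡ true → ∃[ k ] ∃[ r ] (M ≡ index k r × e ≡ exponent k r)

supported-step : ∀ M → Supported M → Supported (suc M) → Supported (4 + M)
supported-step M ih₀ ih₁ e h
  with coeff (shift 8 (γ' M)) e in h₈ | coeff (shift 2 (γ' (suc M))) e in h₂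
... | true | _ =
  let j , e≡ , hj = coeff-shift-true 8 (γ' M) e h₈
      k , r , M≡ , j≡ = ih₀ j hj
  in k , 4 + r , trans (cong (4 +_) M≡) (sym (index-+4 k r)) ,
     trans e≡ (trans (cong (8 +_) j≡) (sym (exponent-+4 k r)))
... | false | true =
  let j , e≡ , hj = coeff-shift-true 2 (γ' (suc M)) e h₂
      k , r , M≡ , j≡ = ih₁ j hj
  in suc k , r , trans (cong (3 +_) M≡) (sym (index-suc k r)) ,
     trans e≡ (trans (cong (2 +_) j≡) (sym (exponent-suc k r)))
... | false | false
  with () ← trans (sym (trans (coeff-⊕ (shift 8 (γ' M)) (shift 2 (γ' (suc M))) e) (cong₂ _xor_ h₈ h₂))) h

γ'-support : ∀ M → Supported M
γ'-support 0 e ()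
γ'-support 1 e ()
γ'-support 2 e h = 0 , 0 , refl , coeff-mono-true 3 e h
γ'-support 3 e h = 0 , 1 , refl , coeff-mono-true 5 e h
γ'-support (suc (suc (suc (suc M)))) = supported-step M (γ'-support M) (γ'-support (suc M))

γcoeff : ℕ → ℕ → Bool
γcoeff k r = coeff (γ' (index k r)) (exponent k r)

γcoeff-step : ∀ k r {M} → index k r ≡ 4 + M →
              γcoeff k r ≡ coeff (shift 8 (γ' M)) (exponent k r) xor coeff (shift 2 (γ' (suc M))) (exponent k r)
γcoeff-step k r {M} index≡ =
  trans (cong (λ N → coeff (γ' N) (exponent k r)) index≡) (coeff-⊕ (shift 8 (γ' M)) (shift 2 (γ' (suc M))) (exponent k r))

shift8-term : ∀ k r {M} → index k (4 + r) ≡ 4 + M → coeff (shift 8 (γ' M)) (exponent k (4 + r)) ≡ γcoeff k r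
shift8-term k r {M} index≡ = begin
  coeff (shift 8 (γ' M)) (exponent k (4 + r)) ≡⟨ cong (coeff (shift 8 (γ' M))) (exponent-+4 k r) ⟩
  coeff (shift 8 (γ' M)) (8 + exponent k r)   ≡⟨ coeff-shift 8 (γ' M) (exponent k r) ⟩
  coeff (γ' M) (exponent k r)                 ≡⟨ cong (λ N → coeff (γ' N) (exponent k r)) M≡ ⟩
  γcoeff k r                                  ∎
  where
  open ≡-Reasoning
  M≡ : M ≡ index k r
  M≡ = +-cancelˡ-≡ 4 _ _ (trans (sym index≡) (index-+4 k r))

shift8-term-vanishes : ∀ k r {M} → index k r ≡ 4 + M → r < 4 → coeff (shift 8 (γ' M)) (exponent k r) ≡ false
shift8-term-vanishes k r {M} index≡ r<4 = ¬-not λ h →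
  let j , e≡ , hj = coeff-shift-true 8 (γ' M) (exponent k r) h
      k' , r' , M≡ , j≡ = γ'-support M j hj
      _ , r≡ = index-exponent-injective {k} {r} {k'} {4 + r'}
                 (trans index≡ (trans (cong (4 +_) M≡) (sym (index-+4 k' r'))))
                 (trans e≡ (trans (cong (8 +_) j≡) (sym (exponent-+4 k' r'))))
  in <⇒≱ r<4 (subst (4 ≤_) (sym r≡) (m≤m+n 4 r'))

shift2-term : ∀ k r {M} → index (suc k) r ≡ 4 + M → coeff (shift 2 (γ' (suc M))) (exponent (suc k) r) ≡ γcoeff k r
shift2-term k r {M} index≡ = begin
  coeff (shift 2 (γ' (suc M))) (exponent (suc k) r) ≡⟨ cong (coeff (shift 2 (γ' (suc M)))) (exponent-suc k r) ⟩
  coeff (shift 2 (γ' (suc M))) (2 + exponent k r)   ≡⟨ coeff-shift 2 (γ' (suc M)) (exponent k r) ⟩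
  coeff (γ' (suc M)) (exponent k r)                 ≡⟨ cong (λ N → coeff (γ' N) (exponent k r)) 1+M≡ ⟩
  γcoeff k r                                        ∎
  where
  open ≡-Reasoning
  1+M≡ : suc M ≡ index k r
  1+M≡ = +-cancelˡ-≡ 3 _ _ (trans (sym index≡) (index-suc k r))

shift2-term-vanishes : ∀ r {M} → index 0 r ≡ 4 + M → coeff (shift 2 (γ' (suc M))) (exponent 0 r) ≡ false
shift2-term-vanishes r {M} index≡ = ¬-not λ h →
  let j , e≡ , hj = coeff-shift-true 2 (γ' (suc M)) (exponent 0 r) h
      k' , r' , M≡ , j≡ = γ'-support (suc M) j hj
  in 0≢1+n (proj₁ (index-exponent-injective {0} {r} {suc k'} {r'}
       (trans index≡ (trans (cong (3 +_) M≡) (sym (index-suc k' r'))))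
       (trans e≡ (trans (cong (2 +_) j≡) (sym (exponent-suc k' r'))))))

quad-suc : ∀ i s → 4 * suc i + s ≡ 4 + (4 * i + s)
quad-suc = solve-∀

γcoeff-formula : ∀ k i s → s < 4 → γcoeff k (4 * i + s) ≡ (s ≤ᵇ 1) ∧ carryFree k i
γcoeff-formula zero zero 0 _ = refl
γcoeff-formula zero zero 1 _ = refl
γcoeff-formula zero zero 2 _ = refl
γcoeff-formula zero zero 3 _ = refl
γcoeff-formula zero zero (suc (suc (suc (suc _)))) (s≤s (s≤s (s≤s (s≤s ()))))
γcoeff-formula zero (suc i) s s<4 = begin
  γcoeff 0 (4 * suc i + s)       ≡⟨ cong (γcoeff 0) (quad-suc i s) ⟩
  γcoeff 0 (4 + r)               ≡⟨ γcoeff-step 0 (4 + r) index≡ ⟩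
  coeff (shift 8 (γ' M)) (exponent 0 (4 + r)) xor coeff (shift 2 (γ' (suc M))) (exponent 0 (4 + r))
                                 ≡⟨ cong₂ _xor_ (shift8-term 0 r index≡) (shift2-term-vanishes (4 + r) index≡) ⟩
  γcoeff 0 r xor false           ≡⟨ xor-identityʳ _ ⟩
  γcoeff 0 r                     ≡⟨ γcoeff-formula 0 i s s<4 ⟩
  (s ≤ᵇ 1) ∧ true                ∎
  where
  open ≡-Reasoning
  r = 4 * i + s
  M = index 0 r
  index≡ : index 0 (4 + r) ≡ 4 + M
  index≡ = index-+4 0 r
γcoeff-formula (suc k) zero s s<4 = begin
  γcoeff (suc k) s               ≡⟨ γcoeff-step (suc k) s index≡ ⟩
  coeff (shift 8 (γ' M)) (exponent (suc k) s) xor coeff (shift 2 (γ' (suc M))) (exponent (suc k) s)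
                                 ≡⟨ cong₂ _xor_ (shift8-term-vanishes (suc k) s index≡ s<4) (shift2-term k s index≡) ⟩
  γcoeff k s                     ≡⟨ γcoeff-formula k 0 s s<4 ⟩
  (s ≤ᵇ 1) ∧ carryFree k 0       ≡⟨ cong ((s ≤ᵇ 1) ∧_) (trans (carryFree-zeroʳ k) (sym (carryFree-zeroʳ (suc k)))) ⟩
  (s ≤ᵇ 1) ∧ carryFree (suc k) 0 ∎
  where
  open ≡-Reasoning
  M = 1 + 3 * k + s
  index≡ : index (suc k) s ≡ 4 + M
  index≡ = index-suc k s
γcoeff-formula (suc k) (suc i) s s<4 = begin
  γcoeff (suc k) (4 * suc i + s)
    ≡⟨ cong (γcoeff (suc k)) (quad-suc i s) ⟩
  γcoeff (suc k) (4 + r)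
    ≡⟨ γcoeff-step (suc k) (4 + r) index≡ ⟩
  coeff (shift 8 (γ' M)) (exponent (suc k) (4 + r)) xor coeff (shift 2 (γ' (suc M))) (exponent (suc k) (4 + r))
    ≡⟨ cong₂ _xor_ (shift8-term (suc k) r index≡) (shift2-term k (4 + r) index≡) ⟩
  γcoeff (suc k) r xor γcoeff k (4 + r)
    ≡⟨ cong₂ _xor_ (γcoeff-formula (suc k) i s s<4)
                   (trans (cong (γcoeff k) (sym (quad-suc i s))) (γcoeff-formula k (suc i) s s<4)) ⟩
  (s ≤ᵇ 1) ∧ carryFree (suc k) i xor (s ≤ᵇ 1) ∧ carryFree k (suc i)
    ≡⟨ ∧-distribˡ-xor (s ≤ᵇ 1) _ _ ⟨
  (s ≤ᵇ 1) ∧ (carryFree (suc k) i xor carryFree k (suc i))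
    ≡⟨ cong ((s ≤ᵇ 1) ∧_) (trans (xor-comm (carryFree (suc k) i) (carryFree k (suc i))) (sym (carryFree-pascal k i))) ⟩
  (s ≤ᵇ 1) ∧ carryFree (suc k) (suc i) ∎
  where
  open ≡-Reasoning
  r = 4 * i + s
  M = index (suc k) r
  index≡ : index (suc k) (4 + r) ≡ 4 + M
  index≡ = index-+4 (suc k) r

bracket-evens-odds : ∀ N → 1 + 2 * N ≡ bracket (evens N) (odds N)
bracket-evens-odds N = begin
  1 + 2 * N                                 ≡⟨ cong (λ n → 1 + 2 * n) (interleave-evens-odds N) ⟨
  1 + 2 * (g (evens N) + 2 * g (odds N))    ≡⟨ distribute (g (evens N)) (g (odds N)) ⟩
  1 + 2 * g (evens N) + 4 * g (odds N)      ∎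
  where
  open ≡-Reasoning
  distribute : ∀ x y → 1 + 2 * (x + 2 * y) ≡ 1 + 2 * x + 4 * y
  distribute = solve-∀

precedes-of-weights : ∀ {a b c d} → c + d ≤ a + b → c + 2 * d < a + 2 * b → Precedes c d a b
precedes-of-weights {a} {b} {c} {d} c+d≤a+b lt with m≤n⇒m<n∨m≡n c+d≤a+b
... | inj₁ c+d<a+b = inj₁ c+d<a+b
... | inj₂ c+d≡a+b =
  inj₂ (c+d≡a+b , +-cancelˡ-< (a + b) d b (subst₂ _<_ (trans (split c d) (cong (_+ d) c+d≡a+b)) (split a b) lt))
  where
  split : ∀ x y → x + 2 * y ≡ (x + y) + y
  split = solve-∀

weights-increase : ∀ k i s → s < 2 → carryFree k i ≡ true →
                   w₁ (k + ((1 + s) + 4 * i)) ≤ w₁ ((2 + s) + 4 * i + 3 * k)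
                   × w₂ (k + ((1 + s) + 4 * i)) < w₂ ((2 + s) + 4 * i + 3 * k)
weights-increase k i s s<2 carry-free =
  cancel-≤ w₁-exchange (proj₁ (low-weights s s<2)) ,
  cancel-< w₂-exchange (proj₂ (low-weights s s<2))
  where
  additive = w-additive k i carry-free
  1+s<4 : 1 + s < 4
  1+s<4 = s≤s (s≤s (<⇒≤ s<2))
  2+s<4 : 2 + s < 4
  2+s<4 = s≤s (s≤s s<2)
  w₁-exchange = weight-exchange w₁ w₁-subadditive (λ c m c<4 → proj₁ (w-quad c m c<4)) k i (1 + s) (2 + s) (proj₁ additive) 1+s<4 2+s<4
  w₂-exchange = weight-exchange w₂ w₂-subadditive (λ c m c<4 → proj₂ (w-quad c m c<4)) k i (1 + s) (2 + s) (proj₂ additive) 1+s<4 2+s<4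
  low-weights : ∀ s → s < 2 → w₁ (1 + s) ≤ w₁ (2 + s) × w₂ (1 + s) < w₂ (2 + s)
  low-weights 0 _ = s≤s z≤n , s≤s (s≤s z≤n)
  low-weights 1 _ = s≤s z≤n , s≤s (s≤s (s≤s z≤n))
  low-weights (suc (suc _)) (s≤s (s≤s ()))
  open ≤-Reasoning
  cancel-≤ : ∀ {x y u v} → x + u ≤ v + y → v ≤ u → x ≤ y
  cancel-≤ {x} {y} {u} {v} x+u≤v+y v≤u = +-cancelʳ-≤ u x y (begin
    x + u ≤⟨ x+u≤v+y ⟩
    v + y ≤⟨ +-monoˡ-≤ y v≤u ⟩
    u + y ≡⟨ +-comm u y ⟩
    y + u ∎)
  cancel-< : ∀ {x y u v} → x + u ≤ v + y → v < u → x < y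
  cancel-< {x} {y} {u} {v} x+u≤v+y v<u = +-cancelʳ-≤ v (suc x) y (begin
    suc (x + v) ≡⟨ +-suc x v ⟨
    x + suc v   ≤⟨ +-monoʳ-≤ x v<u ⟩
    x + u       ≤⟨ x+u≤v+y ⟩
    v + y       ≡⟨ +-comm v y ⟩
    y + v       ∎)

MonomialPrecedes : ℕ → ℕ → Set
MonomialPrecedes e n = ∃[ a ] ∃[ b ] ∃[ c ] ∃[ d ] (n ≡ bracket a b × e ≡ bracket c d × Precedes c d a b)

carry-free-monomial-precedes : ∀ k i s → s < 2 → carryFree k i ≡ true →
                               MonomialPrecedes (exponent k (4 * i + s)) (1 + 2 * index k (4 * i + s))
carry-free-monomial-precedes k i s s<2 carry-free =
  evens M , odds M , evens J , odds J ,
  trans (cong (λ n → 1 + 2 * n) (M≡ k i s)) (bracket-evens-odds M) ,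
  trans (J≡ k i s) (bracket-evens-odds J) ,
  precedes-of-weights {evens M} {odds M} {evens J} {odds J} (proj₁ increase) (proj₂ increase)
  where
  M J : ℕ
  M = (2 + s) + 4 * i + 3 * k
  J = k + ((1 + s) + 4 * i)
  M≡ : ∀ k i s → 2 + 3 * k + (4 * i + s) ≡ (2 + s) + 4 * i + 3 * k
  M≡ = solve-∀
  J≡ : ∀ k i s → 3 + 2 * (k + (4 * i + s)) ≡ 1 + 2 * (k + ((1 + s) + 4 * i))
  J≡ = solve-∀
  increase = weights-increase k i s s<2 carry-free

monomial-precedes : ∀ {m e} k i s → s < 4 → m ≡ index k (4 * i + s) → e ≡ exponent k (4 * i + s) →
                    coeff (γ' m) e ≡ true → MonomialPrecedes e (1 + 2 * m)
monomial-precedes k i s s<4 refl refl h with s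
... | 0 = carry-free-monomial-precedes k i 0 z<s (trans (sym (γcoeff-formula k i 0 s<4)) h)
... | 1 = carry-free-monomial-precedes k i 1 (n<1+n 1) (trans (sym (γcoeff-formula k i 1 s<4)) h)
... | 2 with () ← trans (sym (γcoeff-formula k i 2 s<4)) h
... | 3 with () ← trans (sym (γcoeff-formula k i 3 s<4)) h
... | suc (suc (suc (suc _))) with s≤s (s≤s (s≤s (s≤s ()))) ← s<4

corollary3p2 : (m : ℕ) → SumOfMonomialsPreceding (γ' m) (1 + 2 * m)
corollary3p2 m e h with γ'-support m e h
... | k , r , m≡ , e≡ =
  monomial-precedes k (r / 4) (r % 4) (m%n<n r 4) (trans m≡ (cong (index k) r≡)) (trans e≡ (cong (exponent k) r≡)) h
  where
  r≡ : r ≡ 4 * (r / 4) + r % 4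
  r≡ = trans (m≡m%n+[m/n]*n r 4) (trans (+-comm (r % 4) _) (cong (_+ r % 4) (*-comm (r / 4) 4)))
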